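{- For every integer $m>2$, $$\mathrm{mpf}_{m,2}(1)=\begin{cases}2^{\frac{m+1}{2}}&\text{if $m$ is odd},\\ 3\cdot 2^{\frac m2-1}&\text{if $m$ is even}.\end{cases}$$
   Context: $[n]=\{1,\dots,n\}$. The $t$-metered parking scheme for $\alpha=(a_1,\dots,a_m)\in[n]^m$: there are $n$ spots $1,\dots,n$; cars $1,\dots,m$ arrive in order; car $i$ drives to spot $a_i$, parks there if unoccupied, and otherwise parks in the first unoccupied spot numbered greater than $a_i$; if there is none, the car fails to park. Immediately after car $j$ parks, car $j-t$ (if $j-t\ge1$) leaves. $\alpha$ is a $t$-metered $(m,n)$-parking function if all $m$ cars park; $\mathrm{mpf}_{m,n}(t)$ is the number of such $\alpha\in[n]^m$. -}

module Defs where

open import Data.Nat using (ℕ; zero; suc; _+_; _∸_; _≤ᵇ_; _≡ᵇ_)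
open import Data.Bool using (Bool; true; false; if_then_else_)
open import Data.Fin using (Fin; toℕ)
open import Data.Maybe using (Maybe; just; nothing)
open import Data.Vec using (Vec; []; _∷_; replicate; allFin)
open import Data.List using (List; []; _∷_; concatMap; map; length; filter)
open import Relation.Nullary using (Dec; yes; no)
open import Data.Bool.Properties using (T?)

-- A parking lot with n spots, spots 1..n represented by indices 0..n-1.
-- Each spot holds `nothing` (unoccupied) or `just c` (occupied by car c,
-- cars numbered 1,2,...).
Lot : ℕ → Set
Lot n = Vec (Maybe ℕ) n

-- park car c whose preferred spot has 0-based index p:
-- occupy the first unoccupied spot with index ≥ p; return nothing if none.
-- (k is the 0-based index of the current head spot.)
parkFrom : ∀ {n} → ℕ → ℕ → ℕ → Lot n → Maybe (Lot n)
parkFrom c p k [] = nothing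
parkFrom c p k (nothing ∷ s) with p ≤ᵇ k
... | true  = just (just c ∷ s)
... | false with parkFrom c p (suc k) s
...   | nothing = nothing
...   | just s' = just (nothing ∷ s')
parkFrom c p k (just d ∷ s) with parkFrom c p (suc k) s
... | nothing = nothing
... | just s' = just (just d ∷ s')

park : ∀ {n} → ℕ → ℕ → Lot n → Maybe (Lot n)
park c p = parkFrom c p 0

leave : ∀ {n} → ℕ → Lot n → Lot n
leave c [] = []
leave c (nothing ∷ s) = nothing ∷ leave c s
leave c (just d ∷ s) = (if d ≡ᵇ c then nothing else just d) ∷ leave c s

-- Run the t-metered parking scheme: j is the number of the next car to
-- arrive. After car j parks, car j - t leaves, provided j - t ≥ 1.
-- Returns true iff all remaining cars park.
runMetered : ∀ {n m} → ℕ → ℕ → Lot n → Vec (Fin n) m → Bool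
runMetered t j s [] = true
runMetered t j s (a ∷ as) with park j (toℕ a) s
... | nothing = false
... | just s' =
  runMetered t (suc j) (if (suc t) ≤ᵇ j then leave (j ∸ t) s' else s') as

-- α ∈ [n]^m (as a vector of 0-based spot indices) is a t-metered
-- (m,n)-parking function
isMeteredPF : ∀ {n m} → ℕ → Vec (Fin n) m → Bool
isMeteredPF {n} t α = runMetered t 1 (replicate n nothing) α

allVecs : (n m : ℕ) → List (Vec (Fin n) m)
allVecs n zero = [] ∷ []
allVecs n (suc m) =
  concatMap (λ a → map (a ∷_) (allVecs n m)) (Data.Vec.toList (allFin n))

mpf : (m n t : ℕ) → ℕ
mpf m n t = length (filter (λ α → T? (isMeteredPF t α)) (allVecs n m))

-- With t = 1 and two spots, after every arrival the lot holds exactly the car that has just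
-- parked. If it sits in spot 1, the next car parks in spot 2 whatever its preference; if it
-- sits in spot 2, the next car parks only if it prefers spot 1. So the numbers of successful
-- continuations of length k from these two states obey the recursion defining parkable₁ and
-- parkable₂, whence mpf (m+2) = 2 mpf m, starting from mpf 1 = 2 and mpf 2 = 3.
module Submission where

open import Defs
open import Data.Nat using (ℕ; _+_; _*_; _^_; _<_; _/_; _∸_; _%_)
open import Relation.Binary.PropositionalEquality using (_≡_)
open import Data.Product using (_×_)

open import Data.Product using (_,_)
open import Data.Nat using (zero; suc; _≡ᵇ_; s≤s; z≤n)
open import Data.Nat.Properties using (*-distribˡ-+; +-comm; +-identityʳ; *-assoc; <-trans)
open import Data.Nat.DivMod using (m≡m%n+[m/n]*n; m*n/n≡m)
open import Data.Bool using (Bool; true; false; T)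
open import Data.Fin using (Fin; zero; suc)
open import Data.Maybe using (just; nothing)
open import Data.Vec using (Vec; []; _∷_)
open import Data.List using (List; []; _∷_; _++_; map; concatMap; length; filterᵇ)
open import Data.Nat.ListAction using (sum)
open import Data.List.Properties using (length-++; filter-++; filter-≐)
open import Data.Bool.Properties using (T?)
open import Function using (_∘_; const)
open import Relation.Binary.PropositionalEquality
  using (refl; sym; trans; cong; cong₂; subst; module ≡-Reasoning)

private
  variable
    A B : Set

countᵇ : (A → Bool) → List A → ℕ
countᵇ p xs = length (filterᵇ p xs)

countᵇ-++ : ∀ p (xs ys : List A) → countᵇ p (xs ++ ys) ≡ countᵇ p xs + countᵇ p ys
countᵇ-++ p xs ys = trans (cong length (filter-++ (T? ∘ p) xs ys)) (length-++ (filterᵇ p xs))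

countᵇ-cong : ∀ {p q : A → Bool} → (∀ x → p x ≡ q x) → ∀ xs → countᵇ p xs ≡ countᵇ q xs
countᵇ-cong {p = p} {q} p≗q xs =
  cong length (filter-≐ (T? ∘ p) (T? ∘ q)
    ((λ {x} → subst T (p≗q x)) , (λ {x} → subst T (sym (p≗q x)))) xs)

countᵇ-false : ∀ (xs : List A) → countᵇ (const false) xs ≡ 0
countᵇ-false []       = refl
countᵇ-false (_ ∷ xs) = countᵇ-false xs

countᵇ-map : ∀ p (f : B → A) xs → countᵇ p (map f xs) ≡ countᵇ (p ∘ f) xs
countᵇ-map p f []       = refl
countᵇ-map p f (x ∷ xs) with p (f x)
... | true  = cong suc (countᵇ-map p f xs)
... | false = countᵇ-map p f xs

countᵇ-concatMap : ∀ p (f : B → List A) xs → countᵇ p (concatMap f xs) ≡ sum (map (countᵇ p ∘ f) xs)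
countᵇ-concatMap p f []       = refl
countᵇ-concatMap p f (x ∷ xs) =
  trans (countᵇ-++ p (f x) (concatMap f xs)) (cong (countᵇ p (f x) +_) (countᵇ-concatMap p f xs))

countᵇ-allVecs₂ : ∀ k p → countᵇ p (allVecs 2 (suc k)) ≡
                  countᵇ (p ∘ (zero ∷_)) (allVecs 2 k) + countᵇ (p ∘ (suc zero ∷_)) (allVecs 2 k)
countᵇ-allVecs₂ k p = begin
  countᵇ p (allVecs 2 (suc k))
    ≡⟨ countᵇ-concatMap p (λ a → map (a ∷_) (allVecs 2 k)) (zero ∷ suc zero ∷ []) ⟩
  countᵇ p (map (zero ∷_) (allVecs 2 k)) + (countᵇ p (map (suc zero ∷_) (allVecs 2 k)) + 0)
    ≡⟨ cong₂ _+_ (countᵇ-map p (zero ∷_) (allVecs 2 k))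
                 (trans (+-identityʳ _) (countᵇ-map p (suc zero ∷_) (allVecs 2 k))) ⟩
  countᵇ (p ∘ (zero ∷_)) (allVecs 2 k) + countᵇ (p ∘ (suc zero ∷_)) (allVecs 2 k) ∎
  where open ≡-Reasoning

onlyIn₁ onlyIn₂ : ℕ → Lot 2
onlyIn₁ c = just c ∷ nothing ∷ []
onlyIn₂ c = nothing ∷ just c ∷ []

≡ᵇ-refl : ∀ n → (n ≡ᵇ n) ≡ true
≡ᵇ-refl zero    = refl
≡ᵇ-refl (suc n) = ≡ᵇ-refl n

suc-≡ᵇ : ∀ n → (suc n ≡ᵇ n) ≡ false
suc-≡ᵇ zero    = refl
suc-≡ᵇ (suc n) = suc-≡ᵇ n

runMetered-onlyIn₁ : ∀ i a {k} (as : Vec (Fin 2) k) →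
  runMetered 1 (2 + i) (onlyIn₁ (suc i)) (a ∷ as) ≡ runMetered 1 (3 + i) (onlyIn₂ (2 + i)) as
runMetered-onlyIn₁ i zero       as rewrite ≡ᵇ-refl i | suc-≡ᵇ i = refl
runMetered-onlyIn₁ i (suc zero) as rewrite ≡ᵇ-refl i | suc-≡ᵇ i = refl

runMetered-onlyIn₂-first : ∀ i {k} (as : Vec (Fin 2) k) →
  runMetered 1 (2 + i) (onlyIn₂ (suc i)) (zero ∷ as) ≡ runMetered 1 (3 + i) (onlyIn₁ (2 + i)) as
runMetered-onlyIn₂-first i as rewrite ≡ᵇ-refl i | suc-≡ᵇ i = refl

runMetered-onlyIn₂-second : ∀ i {k} (as : Vec (Fin 2) k) →
  runMetered 1 (2 + i) (onlyIn₂ (suc i)) (suc zero ∷ as) ≡ false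
runMetered-onlyIn₂-second i as = refl

mutual
  parkable₁ : ℕ → ℕ
  parkable₁ zero    = 1
  parkable₁ (suc k) = 2 * parkable₂ k

  parkable₂ : ℕ → ℕ
  parkable₂ zero    = 1
  parkable₂ (suc k) = parkable₁ k

mutual
  countᵇ-onlyIn₁ : ∀ k i → countᵇ (runMetered 1 (2 + i) (onlyIn₁ (suc i))) (allVecs 2 k) ≡ parkable₁ k
  countᵇ-onlyIn₁ zero    i = refl
  countᵇ-onlyIn₁ (suc k) i =
    trans (countᵇ-allVecs₂ k _)
          (cong₂ _+_ (any-first zero) (trans (any-first (suc zero)) (sym (+-identityʳ _))))
    where
    any-first : ∀ a → countᵇ (λ as → runMetered 1 (2 + i) (onlyIn₁ (suc i)) (a ∷ as)) (allVecs 2 k)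
                      ≡ parkable₂ k
    any-first a = trans (countᵇ-cong (runMetered-onlyIn₁ i a) (allVecs 2 k)) (countᵇ-onlyIn₂ k (suc i))

  countᵇ-onlyIn₂ : ∀ k i → countᵇ (runMetered 1 (2 + i) (onlyIn₂ (suc i))) (allVecs 2 k) ≡ parkable₂ k
  countᵇ-onlyIn₂ zero    i = refl
  countᵇ-onlyIn₂ (suc k) i = begin
    countᵇ (runMetered 1 (2 + i) (onlyIn₂ (suc i))) (allVecs 2 (suc k))
      ≡⟨ countᵇ-allVecs₂ k _ ⟩
    countᵇ (λ as → runMetered 1 (2 + i) (onlyIn₂ (suc i)) (zero ∷ as)) (allVecs 2 k) +
    countᵇ (λ as → runMetered 1 (2 + i) (onlyIn₂ (suc i)) (suc zero ∷ as)) (allVecs 2 k)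
      ≡⟨ cong₂ _+_ (countᵇ-cong (runMetered-onlyIn₂-first i) (allVecs 2 k))
                   (countᵇ-cong (runMetered-onlyIn₂-second i) (allVecs 2 k)) ⟩
    countᵇ (runMetered 1 (3 + i) (onlyIn₁ (2 + i))) (allVecs 2 k) + countᵇ (const false) (allVecs 2 k)
      ≡⟨ cong₂ _+_ (countᵇ-onlyIn₁ k (suc i)) (countᵇ-false (allVecs 2 k)) ⟩
    parkable₁ k + 0
      ≡⟨ +-identityʳ (parkable₁ k) ⟩
    parkable₁ k ∎
    where open ≡-Reasoning

mpf-suc : ∀ k → mpf (suc k) 2 1 ≡ parkable₁ k + parkable₂ k
mpf-suc k = trans (countᵇ-allVecs₂ k _) (cong₂ _+_ (countᵇ-onlyIn₁ k 0) (countᵇ-onlyIn₂ k 0))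

mpf-3+ : ∀ k → mpf (3 + k) 2 1 ≡ 2 * mpf (suc k) 2 1
mpf-3+ k = begin
  mpf (3 + k) 2 1                   ≡⟨ mpf-suc (2 + k) ⟩
  2 * parkable₁ k + 2 * parkable₂ k ≡⟨ *-distribˡ-+ 2 (parkable₁ k) (parkable₂ k) ⟨
  2 * (parkable₁ k + parkable₂ k)   ≡⟨ cong (2 *_) (mpf-suc k) ⟨
  2 * mpf (suc k) 2 1               ∎
  where open ≡-Reasoning

mpf-1+n*2 : ∀ n → mpf (1 + n * 2) 2 1 ≡ 2 ^ suc n
mpf-1+n*2 zero    = refl
mpf-1+n*2 (suc n) = trans (mpf-3+ (n * 2)) (cong (2 *_) (mpf-1+n*2 n))

mpf-2+n*2 : ∀ n → mpf (2 + n * 2) 2 1 ≡ 3 * 2 ^ n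
mpf-2+n*2 zero    = refl
mpf-2+n*2 (suc n) = begin
  mpf (3 + suc (n * 2)) 2 1 ≡⟨ mpf-3+ (suc (n * 2)) ⟩
  2 * mpf (2 + n * 2) 2 1   ≡⟨ cong (2 *_) (mpf-2+n*2 n) ⟩
  2 * (3 * 2 ^ n)           ≡⟨ *-assoc 2 3 (2 ^ n) ⟨
  3 * 2 * 2 ^ n             ≡⟨ *-assoc 3 2 (2 ^ n) ⟩
  3 * 2 ^ suc n             ∎
  where open ≡-Reasoning

m%2≡1⇒mpf : ∀ m → m % 2 ≡ 1 → mpf m 2 1 ≡ 2 ^ ((m + 1) / 2)
m%2≡1⇒mpf m m%2≡1 = begin
  mpf m 2 1                     ≡⟨ cong (λ x → mpf x 2 1) m≡1+[m/2]*2 ⟩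
  mpf (1 + m / 2 * 2) 2 1       ≡⟨ mpf-1+n*2 (m / 2) ⟩
  2 ^ suc (m / 2)               ≡⟨ cong (2 ^_) (m*n/n≡m (suc (m / 2)) 2) ⟨
  2 ^ ((2 + m / 2 * 2) / 2)     ≡⟨ cong (λ x → 2 ^ (x / 2)) (+-comm 1 (1 + m / 2 * 2)) ⟩
  2 ^ ((1 + m / 2 * 2 + 1) / 2) ≡⟨ cong (λ x → 2 ^ ((x + 1) / 2)) m≡1+[m/2]*2 ⟨
  2 ^ ((m + 1) / 2)             ∎
  where
  open ≡-Reasoning
  m≡1+[m/2]*2 : m ≡ 1 + m / 2 * 2
  m≡1+[m/2]*2 = trans (m≡m%n+[m/n]*n m 2) (cong (_+ m / 2 * 2) m%2≡1)

m%2≡0⇒mpf : ∀ m → 0 < m → m % 2 ≡ 0 → mpf m 2 1 ≡ 3 * 2 ^ (m / 2 ∸ 1)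
m%2≡0⇒mpf m 0<m m%2≡0 =
  subst (λ x → mpf x 2 1 ≡ 3 * 2 ^ (m / 2 ∸ 1)) (sym m≡[m/2]*2) (mpf-n*2 (m / 2) (subst (0 <_) m≡[m/2]*2 0<m))
  where
  m≡[m/2]*2 : m ≡ m / 2 * 2
  m≡[m/2]*2 = trans (m≡m%n+[m/n]*n m 2) (cong (_+ m / 2 * 2) m%2≡0)
  mpf-n*2 : ∀ n → 0 < n * 2 → mpf (n * 2) 2 1 ≡ 3 * 2 ^ (n ∸ 1)
  mpf-n*2 (suc n) _ = mpf-2+n*2 n

proposition3p15 : (m : ℕ) → 2 < m →
    (m % 2 ≡ 1 → mpf m 2 1 ≡ 2 ^ ((m + 1) / 2)) ×
    (m % 2 ≡ 0 → mpf m 2 1 ≡ 3 * 2 ^ (m / 2 ∸ 1))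
proposition3p15 m 2<m = m%2≡1⇒mpf m , m%2≡0⇒mpf m (<-trans (s≤s z≤n) 2<m)
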